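{- Let $T_1$ and $T_2$ be standard composition tableaux of size $n$ and let $i_1,\dots,i_p\in[n-1]$ be such that $\pi_{i_p}\cdots\pi_{i_1}T_1=T_2$. Then there is a subsequence $j_q,\dots,j_1$ of $i_p,\dots,i_1$ such that (1) $T_2=\pi_{j_q}\cdots\pi_{j_1}T_1$, and (2) $s_{j_q}\cdots s_{j_1}$ is a reduced word for $\mathrm{col}_{T_2}\mathrm{col}_{T_1}^{ -1}$. In particular, $T_2=\pi_{\mathrm{col}_{T_2}\mathrm{col}_{T_1}^{ -1}}T_1$.
   Context: $\mathfrak S_n$ is the symmetric group on $[n]=\{1,\dots,n\}$, $s_i=(i,i+1)$, permutations are multiplied as functions ($(\sigma\tau)(k)=\sigma(\tau(k))$). A reduced word for $\sigma$ is an expression $\sigma=s_{j_k}\cdots s_{j_1}$ with $k$ minimal; $k=l(\sigma)$ is the length. The 0-Hecke algebra $H_n(0)$ is generated by $\pi_1,\dots,\pi_{n-1}$ with $\pi_i^2=\pi_i$, $\pi_i\pi_{i+1}\pi_i=\pi_{i+1}\pi_i\pi_{i+1}$, $\pi_i\pi_j=\pi_j\pi_i$ ($|i-j|\ge2$); for $\sigma$ with reduced word $s_{j_k}\cdots s_{j_1}$ put $\pi_\sigma=\pi_{j_k}\cdots\pi_{j_1}$ (well defined). Compositions $\alpha=(\alpha_1,\dots,\alpha_l)$ have diagrams $\{(i,j):i\le l, j\le\alpha_i\}$ (matrix coordinates, row 1 on top). The composition poset has cover relation $\beta\lessdot_c\alpha$ iff $\alpha=(1,\beta_1,\dots,\beta_l)$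 or $\alpha$ arises from $\beta$ by replacing $\beta_k$ by $\beta_k+1$ where $\beta_i\neq\beta_k$ for all $i<k$; $\le_c$ is its reflexive-transitive closure. For $\beta\le_c\alpha$ the diagram of $\beta$ is placed at the bottom of that of $\alpha$ (row $r$ of $\beta$ identified with row $r+l(\alpha)-l(\beta)$ of $\alpha$), and the skew shape $\alpha/\!/\beta$ is the set of cells of $\alpha$ not in this copy of $\beta$; its size is $|\alpha|-|\beta|$. A standard composition tableau (SCT) of shape $\alpha/\!/\beta$ of size $n$ is a bijection $T:\alpha/\!/\beta\to[n]$ with entries decreasing along rows left to right, entries in the first column increasing top to bottom, and the triple rule: setting $T(c)=\infty$ for cells $c$ of $\beta$, if $(j,k)\in\alpha/\!/\beta$ and $(i,k-1)\in\alpha$ with $j>i$ and $T(j,k)<T(i,k-1)$, then $(i,k)\in\alpha$ and $T(j,k)<T(i,k)$. Let $c_T(k)$ be the column of $T^{ -1}(k)$. A cell $(i,j)$ attacks $(i',j')$ if $j=j'$ and $i\neq i'$, or $j=j'-1$ and $i<i'$; entry $a$ attacks $b$ in $T$ if $T^{ -1}(a)$ attacks $T^{ -1}(b)$. $D(T)=\{i\in[n-1]:c_T(i)\le c_T(i+1)\}$, $AD(T)=\{i\in D(T): i\text{ attacks } i+1\}$, $nAD(T)=D(T)\setminus AD(T)$. $H_n(0)$ acts on the $\mathbb C$-span of the SCTs of shape $\alpha/\!/\beta$ by $\pi_iT=T$ if $i\notin D(T)$, $0$ if $i\in AD(T)$, and $s_iT$ (interchange entries $i,i+1$) if $i\in nAD(T)$.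 The column word $\mathrm{col}_T\in\mathfrak S_n$ is the word obtained by reading the columns of $T$ from left to right, each column from top to bottom, regarded as a permutation in one-line notation. -}

module Defs where

open import Data.Nat using (ℕ; zero; suc; _+_; _∸_; _≤_; _<_; _≟_; _≤?_; _<?_)
open import Data.Bool using (Bool; true; false; if_then_else_)
open import Data.Product using (Σ; ∃; _×_; _,_; proj₁; proj₂)
open import Data.Product.Properties using (≡-dec)
open import Data.Sum using (_⊎_)
open import Data.List using (List; []; _∷_; length; map; concatMap; filter; upTo; foldr)
open import Data.List.Relation.Unary.All using (All)
open import Data.Vec using (Vec; []; _∷_; toList)
open import Data.Maybe using (Maybe; just; nothing)
open import Relation.Nullary using (¬_; Dec; yes; no; does)
open import Relation.Binary.PropositionalEquality using (_≡_; _≢_)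
open import Relation.Binary.Construct.Closure.ReflexiveTransitive using (Star)

-- default-0 lookup (0-based)
partAt : List ℕ → ℕ → ℕ
partAt []       _       = 0
partAt (x ∷ xs) zero    = x
partAt (x ∷ xs) (suc k) = partAt xs k

incrAt : List ℕ → ℕ → List ℕ
incrAt []       _       = []
incrAt (x ∷ xs) zero    = suc x ∷ xs
incrAt (x ∷ xs) (suc k) = x ∷ incrAt xs k

IsComposition : List ℕ → Set
IsComposition α = All (λ a → 1 ≤ a) α

data _⋖c_ : List ℕ → List ℕ → Set where
  prepend : ∀ β → β ⋖c (1 ∷ β)
  grow    : ∀ β k → k < length β →
            (∀ i → i < k → partAt β i ≢ partAt β k) →
            β ⋖c incrAt β k

_≤c_ : List ℕ → List ℕ → Set
_≤c_ = Star _⋖c_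

-- Cells (row , column), 1-based, matrix coordinates

Cell : Set
Cell = ℕ × ℕ

_≟c_ : (c d : Cell) → Dec (c ≡ d)
_≟c_ = ≡-dec _≟_ _≟_

InD : List ℕ → Cell → Set
InD α (i , j) = 1 ≤ i × i ≤ length α × 1 ≤ j × j ≤ partAt α (i ∸ 1)

-- cell of the copy of β placed at the bottom of α
-- (row r of β is row r + l(α) - l(β) of α)
InInner : List ℕ → List ℕ → Cell → Set
InInner α β (i , j) =
  (length α ∸ length β) < i × i ≤ length α × 1 ≤ j ×
  j ≤ partAt β (i ∸ (length α ∸ length β) ∸ 1)

InSkew : List ℕ → List ℕ → Cell → Set
InSkew α β c = InD α c × ¬ InInner α β c

-- Tableaux of size n, represented by the positions of their entries:
-- the k-th component (0-based) of T : Vec Cell n is the cell T⁻¹(k+1).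

lookupℕ : ∀ {n} → Vec Cell n → ℕ → Cell
lookupℕ []       _       = (0 , 0)
lookupℕ (x ∷ v)  zero    = x
lookupℕ (x ∷ v)  (suc a) = lookupℕ v a

-- pos T a = T⁻¹(a) for a ∈ [n]; (0,0) (never a cell) otherwise
pos : ∀ {n} → Vec Cell n → ℕ → Cell
pos T zero    = (0 , 0)
pos T (suc a) = lookupℕ T a

InRange : ℕ → ℕ → Set
InRange n a = 1 ≤ a × a ≤ n

-- "T(b) < T(c)" with the convention T = ∞ on cells of β
LtInf : ∀ {n} → List ℕ → List ℕ → Vec Cell n → ℕ → Cell → Set
LtInf {n} α β T b c = InInner α β c ⊎ (∃ λ a → InRange n a × pos T a ≡ c × b < a)

record IsSCT (n : ℕ) (α β : List ℕ) (T : Vec Cell n) : Set where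
  field
    inShape : ∀ a → InRange n a → InSkew α β (pos T a)
    inj     : ∀ a b → InRange n a → InRange n b → pos T a ≡ pos T b → a ≡ b
    surj    : ∀ c → InSkew α β c → ∃ λ a → InRange n a × pos T a ≡ c
    rows    : ∀ a b i j → InRange n a → InRange n b →
              pos T a ≡ (i , j) → pos T b ≡ (i , suc j) → b < a
    col1    : ∀ a b i i' → InRange n a → InRange n b →
              pos T a ≡ (i , 1) → pos T b ≡ (i' , 1) → i < i' → a < b
    triple  : ∀ b j k i → InRange n b → pos T b ≡ (j , suc k) →
              InD α (i , k) → i < j → LtInf α β T b (i , k) →
              InD α (i , suc k) × LtInf α β T b (i , suc k)

Attacks : Cell → Cell → Set
Attacks (i , j) (i' , j') = (j ≡ j' × i ≢ i') ⊎ (suc j ≡ j' × i < i')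

attacks? : (c d : Cell) → Dec (Attacks c d)
attacks? (i , j) (i' , j') with j ≟ j' | i ≟ i' | suc j ≟ j' | i <? i'
... | yes p | no q  | _     | _     = yes (Data.Sum.inj₁ (p , q))
... | _     | _     | yes r | yes s = yes (Data.Sum.inj₂ (r , s))
... | yes p | yes q | no r  | _     = no λ { (Data.Sum.inj₁ (_ , q')) → q' q ; (Data.Sum.inj₂ (r' , _)) → r r' }
... | yes p | yes q | yes r | no s  = no λ { (Data.Sum.inj₁ (_ , q')) → q' q ; (Data.Sum.inj₂ (_ , s')) → s s' }
... | no p  | _     | no r  | _     = no λ { (Data.Sum.inj₁ (p' , _)) → p p' ; (Data.Sum.inj₂ (r' , _)) → r r' }
... | no p  | _     | yes r | no s  = no λ { (Data.Sum.inj₁ (p' , _)) → p p' ; (Data.Sum.inj₂ (_ , s')) → s s' }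

swapAt : ∀ {A : Set} {n} → Vec A n → ℕ → Vec A n
swapAt (x ∷ y ∷ v) zero    = y ∷ x ∷ v
swapAt (x ∷ v)     (suc k) = x ∷ swapAt v k
swapAt v           _       = v

swapEntries : ∀ {n} → ℕ → Vec Cell n → Vec Cell n
swapEntries i T = swapAt T (i ∸ 1)

colOf : ∀ {n} → Vec Cell n → ℕ → ℕ
colOf T a = proj₂ (pos T a)

-- π_i T ; nothing stands for 0
πact : ∀ {n} → ℕ → Vec Cell n → Maybe (Vec Cell n)
πact i T with colOf T i ≤? colOf T (suc i)
... | no  _ = just T
... | yes _ with attacks? (pos T i) (pos T (suc i))
...   | yes _ = nothing
...   | no  _ = just (swapEntries i T)

-- applyWord (i₁ ∷ … ∷ i_p) T = π_{i_p} ⋯ π_{i₁} T   (i₁ acts first)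
applyWord : ∀ {n} → List ℕ → Vec Cell n → Maybe (Vec Cell n)
applyWord []       T = just T
applyWord (i ∷ is) T with πact i T
... | nothing = nothing
... | just T' = applyWord is T'

-- Permutations of [n] as functions ℕ → ℕ (compared on [n])

sℕ : ℕ → ℕ → ℕ
sℕ i k with k ≟ i | k ≟ suc i
... | yes _ | _     = suc i
... | no _  | yes _ = i
... | no _  | no _  = k

-- wordPerm (j₁ ∷ … ∷ j_q) = s_{j_q} ⋯ s_{j₁}
wordPerm : List ℕ → ℕ → ℕ
wordPerm []       k = k
wordPerm (j ∷ js) k = wordPerm js (sℕ j k)

PermEq : ℕ → (ℕ → ℕ) → (ℕ → ℕ) → Set
PermEq n f g = ∀ k → InRange n k → f k ≡ g k

Letter : ℕ → ℕ → Set
Letter n j = 1 ≤ j × suc j ≤ n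

IsReducedWord : ℕ → List ℕ → (ℕ → ℕ) → Set
IsReducedWord n w σ =
  All (Letter n) w × PermEq n (wordPerm w) σ ×
  (∀ w' → All (Letter n) w' → PermEq n (wordPerm w') σ → length w ≤ length w')

-- a bound exceeding every row and column index occurring in T
bound : ∀ {n} → Vec Cell n → ℕ
bound T = foldr (λ c m → proj₁ c + proj₂ c + m) 1 (toList T)

oneTo : ℕ → List ℕ
oneTo m = map suc (upTo m)

readCols : ∀ {n} → Vec Cell n → List ℕ
readCols {n} T =
  concatMap (λ c → concatMap (λ r → filter (λ a → pos T a ≟c (r , c)) (oneTo n))
                             (oneTo (bound T)))
            (oneTo (bound T))

-- 1-based lookup, 0 by default
nth1 : List ℕ → ℕ → ℕ
nth1 _        zero          = 0
nth1 []       (suc _)       = 0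
nth1 (x ∷ xs) (suc zero)    = x
nth1 (x ∷ xs) (suc (suc m)) = nth1 xs (suc m)

-- 1-based position of the first occurrence, 0 if absent
index1 : List ℕ → ℕ → ℕ
index1 []       a = 0
index1 (x ∷ xs) a with x ≟ a
... | yes _ = 1
... | no  _ with index1 xs a
...   | zero  = 0
...   | suc m = suc (suc m)

-- col_T in one-line notation, and its inverse
colPerm : ∀ {n} → Vec Cell n → ℕ → ℕ
colPerm T m = nth1 (readCols T) m

colPermInv : ∀ {n} → Vec Cell n → ℕ → ℕ
colPermInv T a = index1 (readCols T) a

colQuot : ∀ {n} → Vec Cell n → Vec Cell n → ℕ → ℕ
colQuot T₂ T₁ a = colPerm T₂ (colPermInv T₁ a)

-- Write ℓ(T) for the number of inversions of the column word of T. Interchanging the entries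
-- i and i+1 changes ℓ by at most one, and π_i acts by such an interchange exactly when the
-- cells of i and i+1 are in reading order and do not attack; then ℓ grows by one. Deleting
-- from the given word the letters that act trivially therefore leaves a word js of such swaps,
-- with col_{T₂} = s_js col_{T₁} and ℓ(T₂) = ℓ(T₁) + |js|. Any word for the same permutation
-- raises ℓ by at most its length, so js is reduced. Conversely, a reduced word w has
-- |w| = ℓ(T₂) - ℓ(T₁), so each of its letters must raise ℓ by one; the inversion it creates
-- persists to T₂ and is not an inversion of T₁, and all such new inversions of T₂ were created
-- by swaps along js, hence do not attack. So every letter of w acts as a swap.
module Submission where

open import Defs
open import Data.List using (List; []; _∷_; length; map; filter; concatMap)
open import Data.List.Properties
  using (filter-accept; filter-reject; filter-none; concatMap-cong; map-concatMap; map-id; map-∘)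
open import Data.List.Membership.Propositional using (_∈_)
open import Data.List.Membership.Propositional.Properties
  using (∈-map⁺; ∈-map⁻; ∈-upTo⁺; ∈-upTo⁻; ∈-concat⁺′; ∈-filter⁺)
open import Data.List.Relation.Binary.Sublist.Propositional using (_⊆_; []; _∷_; _∷ʳ_)
open import Data.List.Relation.Unary.All using (All; []; _∷_)
import Data.List.Relation.Unary.All as All
open import Data.List.Relation.Unary.Any using (here; there)
open import Data.List.Relation.Unary.Unique.Propositional using (Unique; _∷_)
import Data.List.Relation.Unary.Unique.Propositional.Properties as Unique
open import Data.Maybe using (just)
open import Data.Maybe.Properties using (just-injective)
open import Data.Nat using (ℕ; zero; suc; _+_; _∸_; _≤_; _<_; _≟_; _≤?_; _<?_; z≤n; s≤s)
open import Data.Nat.Properties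
open import Algebra.Properties.CommutativeSemigroup +-commutativeSemigroup
  using (interchange; xy∙z≈xz∙y; x∙yz≈y∙xz)
open import Data.Product using (Σ; _×_; _,_; proj₁; proj₂)
open import Data.Sum using (_⊎_; inj₁; inj₂)
open import Data.Vec using (Vec; []; _∷_)
open import Function using (_∘_; id)
open import Relation.Binary.PropositionalEquality
open import Relation.Nullary using (¬_; Dec; yes; no; contradiction)
open import Relation.Nullary.Decidable using (_×-dec_; _⊎-dec_)
open import Relation.Unary using (Decidable)

-- Adjacent transpositions

data TranspositionView (i : ℕ) : ℕ → Set where
  at-i      : TranspositionView i i
  at-suc-i  : TranspositionView i (suc i)
  elsewhere : ∀ {k} → k ≢ i → k ≢ suc i → TranspositionView i k

transpositionView : ∀ i k → TranspositionView i k
transpositionView i k with k ≟ i | k ≟ suc i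
... | yes refl | _        = at-i
... | no _     | yes refl = at-suc-i
... | no k≢i   | no k≢1+i = elsewhere k≢i k≢1+i

sℕ-i : ∀ i → sℕ i i ≡ suc i
sℕ-i i with i ≟ i
... | yes _  = refl
... | no i≢i = contradiction refl i≢i

sℕ-suc-i : ∀ i → sℕ i (suc i) ≡ i
sℕ-suc-i i with suc i ≟ i | suc i ≟ suc i
... | yes 1+i≡i | _     = contradiction 1+i≡i 1+n≢n
... | no _      | yes _ = refl
... | no _      | no ≢  = contradiction refl ≢

sℕ-other : ∀ i {k} → k ≢ i → k ≢ suc i → sℕ i k ≡ k
sℕ-other i {k} k≢i k≢1+i with k ≟ i | k ≟ suc i
... | yes k≡i | _         = contradiction k≡i k≢i
... | no _    | yes k≡1+i = contradiction k≡1+i k≢1+i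
... | no _    | no _      = refl

sℕ-involutive : ∀ i k → sℕ i (sℕ i k) ≡ k
sℕ-involutive i k with transpositionView i k
... | at-i              rewrite sℕ-i i     = sℕ-suc-i i
... | at-suc-i          rewrite sℕ-suc-i i = sℕ-i i
... | elsewhere k≢i k≢1+i rewrite sℕ-other i k≢i k≢1+i = sℕ-other i k≢i k≢1+i

sℕ-zero : ∀ {i} → 1 ≤ i → sℕ i 0 ≡ 0
sℕ-zero {i} 1≤i = sℕ-other i (λ 0≡i → <⇒≢ 1≤i 0≡i) (λ ())

letter-inRange : ∀ {n i} → Letter n i → InRange n i
letter-inRange (1≤i , 1+i≤n) = 1≤i , <⇒≤ 1+i≤n

letter-suc-inRange : ∀ {n i} → Letter n i → InRange n (suc i)
letter-suc-inRange (_ , 1+i≤n) = s≤s z≤n , 1+i≤n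

sℕ-inRange : ∀ {n i k} → Letter n i → InRange n k → InRange n (sℕ i k)
sℕ-inRange {i = i} {k} L k∈ with transpositionView i k
... | at-i     rewrite sℕ-i i     = letter-suc-inRange L
... | at-suc-i rewrite sℕ-suc-i i = letter-inRange L
... | elsewhere k≢i k≢1+i rewrite sℕ-other i k≢i k≢1+i = k∈

data PairView (i : ℕ) : ℕ → ℕ → Set where
  descent : PairView i (suc i) i
  ascent  : PairView i i (suc i)
  generic : ∀ {x y} → ¬ (x ≡ suc i × y ≡ i) → ¬ (x ≡ i × y ≡ suc i) → PairView i x y

pairView : ∀ i x y → PairView i x y
pairView i x y with x ≟ suc i | y ≟ i | x ≟ i | y ≟ suc i
... | yes refl | yes refl | _        | _        = descent
... | _        | _        | yes refl | yes refl = ascent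
... | yes refl | no y≢i   | _        | _        = generic (y≢i ∘ proj₂) (1+n≢n ∘ proj₁)
... | no x≢1+i | _        | yes refl | no y≢1+i = generic (x≢1+i ∘ proj₁) (y≢1+i ∘ proj₂)
... | no x≢1+i | _        | no x≢i   | _        = generic (x≢1+i ∘ proj₁) (x≢i ∘ proj₁)

sℕ-<-generic : ∀ i {x y} → y < x → ¬ (x ≡ suc i × y ≡ i) → sℕ i y < sℕ i x
sℕ-<-generic i {x} {y} y<x ≢ with transpositionView i x | transpositionView i y
... | at-i     | at-i     = contradiction y<x (<-irrefl refl)
... | at-i     | at-suc-i = contradiction y<x (<-asym (n<1+n i))
... | at-i     | elsewhere y≢i y≢1+i rewrite sℕ-i i | sℕ-other i y≢i y≢1+i = m<n⇒m<1+n y<x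
... | at-suc-i | at-i     = contradiction (refl , refl) ≢
... | at-suc-i | at-suc-i = contradiction y<x (<-irrefl refl)
... | at-suc-i | elsewhere y≢i y≢1+i
  rewrite sℕ-suc-i i | sℕ-other i y≢i y≢1+i = ≤∧≢⇒< (≤-pred y<x) y≢i
... | elsewhere x≢i x≢1+i | at-i rewrite sℕ-i i | sℕ-other i x≢i x≢1+i = ≤∧≢⇒< y<x (≢-sym x≢1+i)
... | elsewhere x≢i x≢1+i | at-suc-i rewrite sℕ-suc-i i | sℕ-other i x≢i x≢1+i = <-trans (n<1+n i) y<x
... | elsewhere x≢i x≢1+i | elsewhere y≢i y≢1+i
  rewrite sℕ-other i x≢i x≢1+i | sℕ-other i y≢i y≢1+i = y<x

lookupℕ-swapAt-k : ∀ {n} (v : Vec Cell n) k → suc k < n → lookupℕ (swapAt v k) k ≡ lookupℕ v (suc k)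
lookupℕ-swapAt-k (x ∷ y ∷ v) zero    _           = refl
lookupℕ-swapAt-k (x ∷ y ∷ v) (suc k) (s≤s 2+k<n) = lookupℕ-swapAt-k (y ∷ v) k 2+k<n
lookupℕ-swapAt-k (x ∷ [])    zero    (s≤s ())
lookupℕ-swapAt-k (x ∷ [])    (suc k) (s≤s ())

lookupℕ-swapAt-suc-k : ∀ {n} (v : Vec Cell n) k → suc k < n → lookupℕ (swapAt v k) (suc k) ≡ lookupℕ v k
lookupℕ-swapAt-suc-k (x ∷ y ∷ v) zero    _           = refl
lookupℕ-swapAt-suc-k (x ∷ y ∷ v) (suc k) (s≤s 2+k<n) = lookupℕ-swapAt-suc-k (y ∷ v) k 2+k<n
lookupℕ-swapAt-suc-k (x ∷ [])    zero    (s≤s ())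
lookupℕ-swapAt-suc-k (x ∷ [])    (suc k) (s≤s ())

lookupℕ-swapAt-other : ∀ {n} (v : Vec Cell n) k {y} → y ≢ k → y ≢ suc k →
                       lookupℕ (swapAt v k) y ≡ lookupℕ v y
lookupℕ-swapAt-other []           k       _ _ = refl
lookupℕ-swapAt-other (x ∷ [])     zero    _ _ = refl
lookupℕ-swapAt-other (x ∷ [])     (suc k) _ _ = refl
lookupℕ-swapAt-other (x ∷ y ∷ v) zero {zero}          y≢k _      = contradiction refl y≢k
lookupℕ-swapAt-other (x ∷ y ∷ v) zero {suc zero}      _   y≢1+k  = contradiction refl y≢1+k
lookupℕ-swapAt-other (x ∷ y ∷ v) zero {suc (suc _)}   _   _      = refl
lookupℕ-swapAt-other (x ∷ y ∷ v) (suc k) {zero}       _   _      = refl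
lookupℕ-swapAt-other (x ∷ y ∷ v) (suc k) {suc _}      y≢k y≢1+k  =
  lookupℕ-swapAt-other (y ∷ v) k (y≢k ∘ cong suc) (y≢1+k ∘ cong suc)

pos-swapEntries : ∀ {n} (T : Vec Cell n) {i} → Letter n i → ∀ x → pos (swapEntries i T) x ≡ pos T (sℕ i x)
pos-swapEntries T {suc i} L zero rewrite sℕ-zero {suc i} (s≤s z≤n) = refl
pos-swapEntries T {suc i} (_ , 2+i≤n) (suc y) with transpositionView (suc i) (suc y)
... | at-i     rewrite sℕ-i (suc i)     = lookupℕ-swapAt-k T i 2+i≤n
... | at-suc-i rewrite sℕ-suc-i (suc i) = lookupℕ-swapAt-suc-k T i 2+i≤n
... | elsewhere y≢ y≢′ rewrite sℕ-other (suc i) y≢ y≢′ =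
  lookupℕ-swapAt-other T i (y≢ ∘ cong suc) (y≢′ ∘ cong suc)

pos-swapEntries-i : ∀ {n} (T : Vec Cell n) {i} → Letter n i → pos (swapEntries i T) i ≡ pos T (suc i)
pos-swapEntries-i T {i} L = trans (pos-swapEntries T L i) (cong (pos T) (sℕ-i i))

pos-swapEntries-suc-i : ∀ {n} (T : Vec Cell n) {i} → Letter n i → pos (swapEntries i T) (suc i) ≡ pos T i
pos-swapEntries-suc-i T {i} L = trans (pos-swapEntries T L (suc i)) (cong (pos T) (sℕ-suc-i i))

-- Finite sums

∑ : ℕ → (ℕ → ℕ) → ℕ
∑ zero    f = 0
∑ (suc m) f = ∑ m f + f (suc m)

∑-cong : ∀ m {f g} → (∀ k → InRange m k → f k ≡ g k) → ∑ m f ≡ ∑ m g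
∑-cong zero    f≗g = refl
∑-cong (suc m) f≗g =
  cong₂ _+_ (∑-cong m (λ k (1≤k , k≤m) → f≗g k (1≤k , m≤n⇒m≤1+n k≤m)))
            (f≗g (suc m) (s≤s z≤n , ≤-refl))

∑-zero : ∀ m {f} → (∀ k → InRange m k → f k ≡ 0) → ∑ m f ≡ 0
∑-zero zero    f≗0 = refl
∑-zero (suc m) f≗0 =
  cong₂ _+_ (∑-zero m (λ k (1≤k , k≤m) → f≗0 k (1≤k , m≤n⇒m≤1+n k≤m)))
            (f≗0 (suc m) (s≤s z≤n , ≤-refl))

∑-+ : ∀ m f g → ∑ m (λ k → f k + g k) ≡ ∑ m f + ∑ m g
∑-+ zero    f g = refl
∑-+ (suc m) f g rewrite ∑-+ m f g = interchange (∑ m f) (∑ m g) (f (suc m)) (g (suc m))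

∑-sℕ : ∀ m {i} f → Letter m i → ∑ m (f ∘ sℕ i) ≡ ∑ m f
∑-sℕ (suc m) {suc i} f (s≤s z≤n , 2+i≤1+m) with m≤n⇒m<n∨m≡n 2+i≤1+m
... | inj₁ 2+i<1+m =
  cong₂ _+_ (∑-sℕ m f (s≤s z≤n , ≤-pred 2+i<1+m))
            (cong f (sℕ-other (suc i) (>⇒≢ (<-trans (n<1+n (suc i)) 2+i<1+m)) (>⇒≢ 2+i<1+m)))
... | inj₂ refl rewrite sℕ-i (suc i) | sℕ-suc-i (suc i)
                      | ∑-cong i {f ∘ sℕ (suc i)} {f} (λ k (_ , k≤i) →
                          cong f (sℕ-other (suc i) (<⇒≢ (s≤s k≤i)) (<⇒≢ (m<n⇒m<1+n (s≤s k≤i)))))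
  = xy∙z≈xz∙y (∑ i f) (f (suc (suc i))) (f (suc i))

δ : ℕ → ℕ → ℕ → ℕ
δ p v k with k ≟ p
... | yes _ = v
... | no  _ = 0

δ-≡ : ∀ p v → δ p v p ≡ v
δ-≡ p v with p ≟ p
... | yes _   = refl
... | no p≢p  = contradiction refl p≢p

δ-≢ : ∀ p v {k} → k ≢ p → δ p v k ≡ 0
δ-≢ p v {k} k≢p with k ≟ p
... | yes k≡p = contradiction k≡p k≢p
... | no _    = refl

∑-δ : ∀ m {p} v → InRange m p → ∑ m (δ p v) ≡ v
∑-δ zero    v (1≤p , p≤0) = contradiction (≤-trans 1≤p p≤0) λ ()
∑-δ (suc m) v (1≤p , p≤1+m) with m≤n⇒m<n∨m≡n p≤1+m
... | inj₁ p<1+m rewrite ∑-δ m v (1≤p , ≤-pred p<1+m) | δ-≢ _ v (>⇒≢ p<1+m) = +-identityʳ v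
... | inj₂ refl  rewrite ∑-zero m {δ (suc m) v} (λ k (_ , k≤m) → δ-≢ (suc m) v (<⇒≢ (s≤s k≤m)))
                       | δ-≡ (suc m) v = refl

δ₂ : ℕ → ℕ → ℕ → ℕ → ℕ → ℕ
δ₂ p q v x y = δ p (δ q v y) x

δ₂-≡ : ∀ p q v → δ₂ p q v p q ≡ v
δ₂-≡ p q v = trans (δ-≡ p (δ q v q)) (δ-≡ q v)

δ₂-≢ : ∀ p q v {x y} → ¬ (x ≡ p × y ≡ q) → δ₂ p q v x y ≡ 0
δ₂-≢ p q v {x} {y} ≢ with x ≟ p
... | yes refl = δ-≢ q v (λ y≡q → ≢ (refl , y≡q))
... | no x≢p   = refl

∑∑-δ₂ : ∀ m {p q} v → InRange m p → InRange m q → ∑ m (λ x → ∑ m (δ₂ p q v x)) ≡ v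
∑∑-δ₂ m {p} {q} v p∈ q∈ = trans (∑-cong m row) (∑-δ m v p∈)
  where
  row : ∀ x → InRange m x → ∑ m (δ₂ p q v x) ≡ δ p v x
  row x _ with x ≟ p
  ... | yes refl = ∑-δ m v q∈
  ... | no _     = ∑-zero m (λ _ _ → refl)

∑∑-+ : ∀ m (f g : ℕ → ℕ → ℕ) →
       ∑ m (λ x → ∑ m (λ y → f x y + g x y)) ≡ ∑ m (λ x → ∑ m (f x)) + ∑ m (λ x → ∑ m (g x))
∑∑-+ m f g = trans (∑-cong m (λ x _ → ∑-+ m (f x) (g x))) (∑-+ m _ _)

-- Inversions of the column word

-- The order in which the column word reads the cells.
_≺_ : Cell → Cell → Set
(i , j) ≺ (i′ , j′) = j < j′ ⊎ (j ≡ j′ × i < i′)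

_≺?_ : ∀ c d → Dec (c ≺ d)
(i , j) ≺? (i′ , j′) = (j <? j′) ⊎-dec ((j ≟ j′) ×-dec (i <? i′))

≺-asym : ∀ {c d} → c ≺ d → ¬ d ≺ c
≺-asym (inj₁ j<j′)        (inj₁ j′<j)        = <-asym j<j′ j′<j
≺-asym (inj₁ j<j′)        (inj₂ (j′≡j , _))  = <⇒≢ j<j′ (sym j′≡j)
≺-asym (inj₂ (j≡j′ , _))  (inj₁ j′<j)        = <⇒≢ j′<j (sym j≡j′)
≺-asym (inj₂ (_ , i<i′))  (inj₂ (_ , i′<i))  = <-asym i<i′ i′<i

𝟙 : ∀ {A : Set} → Dec A → ℕ
𝟙 (yes _) = 1
𝟙 (no  _) = 0

𝟙-yes : ∀ {A : Set} (A? : Dec A) → A → 𝟙 A? ≡ 1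
𝟙-yes (yes _) _ = refl
𝟙-yes (no ¬a) a = contradiction a ¬a

𝟙-no : ∀ {A : Set} (A? : Dec A) → ¬ A → 𝟙 A? ≡ 0
𝟙-no (yes a) ¬a = contradiction a ¬a
𝟙-no (no _)  _  = refl

𝟙≤1 : ∀ {A : Set} (A? : Dec A) → 𝟙 A? ≤ 1
𝟙≤1 (yes _) = ≤-refl
𝟙≤1 (no _)  = z≤n

𝟙-cong : ∀ {A B : Set} (A? : Dec A) (B? : Dec B) → (A → B) → (B → A) → 𝟙 A? ≡ 𝟙 B?
𝟙-cong (yes _) (yes _) _   _   = refl
𝟙-cong (yes a) (no ¬b) A→B _   = contradiction (A→B a) ¬b
𝟙-cong (no ¬a) (yes b) _   B→A = contradiction (B→A b) ¬a
𝟙-cong (no _)  (no _)  _   _   = refl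

inversionAt : ∀ {n} → Vec Cell n → ℕ → ℕ → ℕ
inversionAt T x y = 𝟙 ((y <? x) ×-dec (pos T x ≺? pos T y))

-- The length ℓ(col_T) of the column word: its number of inversions.
inversions : ∀ {n} → Vec Cell n → ℕ
inversions {n} T = ∑ n (λ x → ∑ n (inversionAt T x))

inversions-cong : ∀ {n} {T X : Vec Cell n} → (∀ y → InRange n y → pos T y ≡ pos X y) →
                  inversions T ≡ inversions X
inversions-cong {n} T≗X = ∑-cong n λ x x∈ → ∑-cong n λ y y∈ →
  𝟙-cong _ _ (λ (y<x , x≺y) → y<x , subst₂ _≺_ (T≗X x x∈) (T≗X y y∈) x≺y)
             (λ (y<x , x≺y) → y<x , subst₂ _≺_ (sym (T≗X x x∈)) (sym (T≗X y y∈)) x≺y)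

module _ {n} (T : Vec Cell n) {i} (L : Letter n i) where
  private
    ascent?  = pos T i ≺? pos T (suc i)
    descent? = pos T (suc i) ≺? pos T i

    relabelled : ℕ → ℕ → ℕ
    relabelled x y = inversionAt T (sℕ i x) (sℕ i y)

    no-inversion-upwards : ∀ {X : Vec Cell n} → inversionAt X i (suc i) ≡ 0
    no-inversion-upwards = 𝟙-no _ (λ (1+i<i , _) → <-asym 1+i<i (n<1+n i))

    inversion-downwards : ∀ {X : Vec Cell n} → inversionAt X (suc i) i ≡ 𝟙 (pos X (suc i) ≺? pos X i)
    inversion-downwards = 𝟙-cong _ _ proj₂ (n<1+n i ,_)

    inversionAt-generic : ∀ {x y} → ¬ (x ≡ suc i × y ≡ i) → ¬ (x ≡ i × y ≡ suc i) →
                          inversionAt (swapEntries i T) x y ≡ relabelled x y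
    inversionAt-generic {x} {y} ≢descent ≢ascent = 𝟙-cong _ _
      (λ (y<x , x≺y) → sℕ-<-generic i y<x ≢descent ,
                        subst₂ _≺_ (pos-swapEntries T L x) (pos-swapEntries T L y) x≺y)
      (λ (sy<sx , sx≺sy) → subst₂ _<_ (sℕ-involutive i y) (sℕ-involutive i x)
                              (sℕ-<-generic i sy<sx ≢descent′) ,
                            subst₂ _≺_ (sym (pos-swapEntries T L x)) (sym (pos-swapEntries T L y)) sx≺sy)
      where
      ≢descent′ : ¬ (sℕ i x ≡ suc i × sℕ i y ≡ i)
      ≢descent′ (sx≡1+i , sy≡i) =
        ≢ascent ( trans (sym (sℕ-involutive i x)) (trans (cong (sℕ i) sx≡1+i) (sℕ-suc-i i))
                , trans (sym (sℕ-involutive i y)) (trans (cong (sℕ i) sy≡i) (sℕ-i i)))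

    -- The point masses account for the pair {i, i+1}, the only one whose order s_i reverses.
    inversionAt-swapEntries : ∀ x y → inversionAt (swapEntries i T) x y + δ₂ i (suc i) (𝟙 descent?) x y
                                    ≡ relabelled x y + δ₂ (suc i) i (𝟙 ascent?) x y
    inversionAt-swapEntries x y with pairView i x y
    ... | descent = begin
      inversionAt (swapEntries i T) (suc i) i + δ₂ i (suc i) (𝟙 descent?) (suc i) i
        ≡⟨ cong₂ _+_ (trans inversion-downwards
                            (cong₂ (λ c d → 𝟙 (c ≺? d)) (pos-swapEntries-suc-i T L) (pos-swapEntries-i T L)))
                     (δ₂-≢ i (suc i) _ {suc i} {i} (λ (1+i≡i , _) → 1+n≢n 1+i≡i)) ⟩
      𝟙 ascent? + 0
        ≡⟨ +-comm (𝟙 ascent?) 0 ⟩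
      0 + 𝟙 ascent?
        ≡⟨ cong₂ _+_ (sym (trans (cong₂ (inversionAt T) (sℕ-suc-i i) (sℕ-i i)) no-inversion-upwards))
                     (sym (δ₂-≡ (suc i) i _)) ⟩
      relabelled (suc i) i + δ₂ (suc i) i (𝟙 ascent?) (suc i) i ∎
      where open ≡-Reasoning
    ... | ascent = begin
      inversionAt (swapEntries i T) i (suc i) + δ₂ i (suc i) (𝟙 descent?) i (suc i)
        ≡⟨ cong₂ _+_ no-inversion-upwards (δ₂-≡ i (suc i) _) ⟩
      0 + 𝟙 descent?
        ≡⟨ +-comm 0 (𝟙 descent?) ⟩
      𝟙 descent? + 0
        ≡⟨ cong₂ _+_ (sym (trans (cong₂ (inversionAt T) (sℕ-i i) (sℕ-suc-i i)) inversion-downwards))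
                     (sym (δ₂-≢ (suc i) i _ {i} {suc i} (λ (i≡1+i , _) → 1+n≢n (sym i≡1+i)))) ⟩
      relabelled i (suc i) + δ₂ (suc i) i (𝟙 ascent?) i (suc i) ∎
      where open ≡-Reasoning
    ... | generic ≢descent ≢ascent =
      cong₂ _+_ (inversionAt-generic ≢descent ≢ascent)
                (trans (δ₂-≢ i (suc i) _ {x} {y} ≢ascent) (sym (δ₂-≢ (suc i) i _ {x} {y} ≢descent)))

  inversions-swapEntries : inversions (swapEntries i T) + 𝟙 descent? ≡ inversions T + 𝟙 ascent?
  inversions-swapEntries = begin
    inversions (swapEntries i T) + 𝟙 descent?
      ≡⟨ cong (inversions (swapEntries i T) +_) (sym (∑∑-δ₂ n _ (letter-inRange L) (letter-suc-inRange L))) ⟩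
    inversions (swapEntries i T) + ∑ n (λ x → ∑ n (δ₂ i (suc i) (𝟙 descent?) x))
      ≡⟨ sym (∑∑-+ n (inversionAt (swapEntries i T)) (δ₂ i (suc i) (𝟙 descent?))) ⟩
    ∑ n (λ x → ∑ n (λ y → inversionAt (swapEntries i T) x y + δ₂ i (suc i) (𝟙 descent?) x y))
      ≡⟨ ∑-cong n (λ x _ → ∑-cong n (λ y _ → inversionAt-swapEntries x y)) ⟩
    ∑ n (λ x → ∑ n (λ y → relabelled x y + δ₂ (suc i) i (𝟙 ascent?) x y))
      ≡⟨ ∑∑-+ n relabelled (δ₂ (suc i) i (𝟙 ascent?)) ⟩
    ∑ n (λ x → ∑ n (relabelled x)) + ∑ n (λ x → ∑ n (δ₂ (suc i) i (𝟙 ascent?) x))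
      ≡⟨ cong₂ _+_ reindex (∑∑-δ₂ n _ (letter-suc-inRange L) (letter-inRange L)) ⟩
    inversions T + 𝟙 ascent? ∎
    where
    open ≡-Reasoning
    reindex : ∑ n (λ x → ∑ n (relabelled x)) ≡ inversions T
    reindex = trans (∑-cong n (λ x _ → ∑-sℕ n (inversionAt T (sℕ i x)) L))
                    (∑-sℕ n (λ x → ∑ n (inversionAt T x)) L)

  inversions-swapEntries-≤ : inversions (swapEntries i T) ≤ suc (inversions T)
  inversions-swapEntries-≤ = begin
    inversions (swapEntries i T)              ≤⟨ m≤m+n _ (𝟙 descent?) ⟩
    inversions (swapEntries i T) + 𝟙 descent? ≡⟨ inversions-swapEntries ⟩
    inversions T + 𝟙 ascent?                 ≤⟨ +-monoʳ-≤ (inversions T) (𝟙≤1 ascent?) ⟩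
    inversions T + 1                         ≡⟨ +-comm (inversions T) 1 ⟩
    suc (inversions T)                       ∎
    where open ≤-Reasoning

  inversions-swapEntries-≺ : pos T i ≺ pos T (suc i) → inversions (swapEntries i T) ≡ suc (inversions T)
  inversions-swapEntries-≺ c≺d = begin
    inversions (swapEntries i T)              ≡⟨ sym (+-identityʳ _) ⟩
    inversions (swapEntries i T) + 0
      ≡⟨ cong (inversions (swapEntries i T) +_) (sym (𝟙-no descent? (≺-asym c≺d))) ⟩
    inversions (swapEntries i T) + 𝟙 descent? ≡⟨ inversions-swapEntries ⟩
    inversions T + 𝟙 ascent?                 ≡⟨ cong (inversions T +_) (𝟙-yes ascent? c≺d) ⟩
    inversions T + 1                         ≡⟨ +-comm (inversions T) 1 ⟩
    suc (inversions T)                       ∎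
    where open ≡-Reasoning

  inversions-swapEntries-⊀ : ¬ pos T i ≺ pos T (suc i) → inversions (swapEntries i T) ≤ inversions T
  inversions-swapEntries-⊀ c⊀d = begin
    inversions (swapEntries i T)              ≤⟨ m≤m+n _ (𝟙 descent?) ⟩
    inversions (swapEntries i T) + 𝟙 descent? ≡⟨ inversions-swapEntries ⟩
    inversions T + 𝟙 ascent?                 ≡⟨ cong (inversions T +_) (𝟙-no ascent? c⊀d) ⟩
    inversions T + 0                         ≡⟨ +-identityʳ _ ⟩
    inversions T                             ∎
    where open ≤-Reasoning

Relabelling : ∀ {n} → (ℕ → ℕ) → Vec Cell n → Vec Cell n → Set
Relabelling {n} σ T X = ∀ y → InRange n y → pos X (σ y) ≡ pos T y

relabelling-∷⁻ : ∀ {n} {T X : Vec Cell n} {j} w → Letter n j →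
                 Relabelling (wordPerm (j ∷ w)) T X → Relabelling (wordPerm w) (swapEntries j T) X
relabelling-∷⁻ {T = T} {X} {j} w L rel y y∈ = begin
  pos X (wordPerm w y)                  ≡⟨ cong (pos X ∘ wordPerm w) (sym (sℕ-involutive j y)) ⟩
  pos X (wordPerm (j ∷ w) (sℕ j y))     ≡⟨ rel (sℕ j y) (sℕ-inRange L y∈) ⟩
  pos T (sℕ j y)                        ≡⟨ sym (pos-swapEntries T L y) ⟩
  pos (swapEntries j T) y               ∎
  where open ≡-Reasoning

relabelling-∷⁺ : ∀ {n} {T X : Vec Cell n} {j} w → Letter n j →
                 Relabelling (wordPerm w) (swapEntries j T) X → Relabelling (wordPerm (j ∷ w)) T X
relabelling-∷⁺ {T = T} {X} {j} w L rel y y∈ = begin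
  pos X (wordPerm w (sℕ j y))           ≡⟨ rel (sℕ j y) (sℕ-inRange L y∈) ⟩
  pos (swapEntries j T) (sℕ j y)        ≡⟨ pos-swapEntries T L (sℕ j y) ⟩
  pos T (sℕ j (sℕ j y))                 ≡⟨ cong (pos T) (sℕ-involutive j y) ⟩
  pos T y                               ∎
  where open ≡-Reasoning

inversions-relabelling-≤ : ∀ {n} w → All (Letter n) w → {T X : Vec Cell n} →
                           Relabelling (wordPerm w) T X → inversions X ≤ inversions T + length w
inversions-relabelling-≤ [] [] rel =
  ≤-reflexive (trans (inversions-cong rel) (sym (+-identityʳ _)))
inversions-relabelling-≤ (j ∷ w) (L ∷ Ls) {T} {X} rel = begin
  inversions X                            ≤⟨ inversions-relabelling-≤ w Ls (relabelling-∷⁻ w L rel) ⟩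
  inversions (swapEntries j T) + length w ≤⟨ +-monoˡ-≤ (length w) (inversions-swapEntries-≤ T L) ⟩
  suc (inversions T) + length w           ≡⟨ sym (+-suc (inversions T) (length w)) ⟩
  inversions T + length (j ∷ w)           ∎
  where open ≤-Reasoning

PosInjective : ∀ {n} → Vec Cell n → Set
PosInjective {n} T = ∀ a b → InRange n a → InRange n b → pos T a ≡ pos T b → a ≡ b

swapEntries-posInjective : ∀ {n} {T : Vec Cell n} {i} → Letter n i →
                           PosInjective T → PosInjective (swapEntries i T)
swapEntries-posInjective {T = T} {i} L inj a b a∈ b∈ pa≡pb =
  trans (sym (sℕ-involutive i a))
        (trans (cong (sℕ i) (inj (sℕ i a) (sℕ i b) (sℕ-inRange L a∈) (sℕ-inRange L b∈)
                               (trans (sym (pos-swapEntries T L a)) (trans pa≡pb (pos-swapEntries T L b)))))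
               (sℕ-involutive i b))

pos-ext : ∀ {n} {T X : Vec Cell n} → (∀ y → InRange n y → pos T y ≡ pos X y) → T ≡ X
pos-ext {T = []}    {[]}    _   = refl
pos-ext {T = x ∷ T} {y ∷ X} T≗X = cong₂ _∷_ (T≗X 1 (≤-refl , s≤s z≤n))
  (pos-ext λ { zero (() , _) ; (suc k) (_ , k≤n) → T≗X (suc (suc k)) (s≤s z≤n , s≤s k≤n) })

data InvertedCells {n} (T : Vec Cell n) (c d : Cell) : Set where
  inverted : ∀ {x y} → InRange n x → InRange n y → pos T x ≡ c → pos T y ≡ d → y < x → c ≺ d →
             InvertedCells T c d

module _ {n} (T : Vec Cell n) {i} (L : Letter n i) where
  invertedCells-swapEntries⁺ : pos T i ≺ pos T (suc i) → ∀ {c d} →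
                               InvertedCells T c d → InvertedCells (swapEntries i T) c d
  invertedCells-swapEntries⁺ c≺d (inverted {x} {y} x∈ y∈ px py y<x c≺′d) with pairView i x y
  ... | descent = contradiction (subst₂ _≺_ (sym px) (sym py) c≺′d) (≺-asym c≺d)
  ... | ascent  = contradiction y<x (<-asym (n<1+n i))
  ... | generic ≢descent _ =
    inverted (sℕ-inRange L x∈) (sℕ-inRange L y∈)
      (trans (pos-swapEntries T L (sℕ i x)) (trans (cong (pos T) (sℕ-involutive i x)) px))
      (trans (pos-swapEntries T L (sℕ i y)) (trans (cong (pos T) (sℕ-involutive i y)) py))
      (sℕ-<-generic i y<x ≢descent) c≺′d

  invertedCells-swapEntries-new : pos T i ≺ pos T (suc i) →
                                  InvertedCells (swapEntries i T) (pos T i) (pos T (suc i))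
  invertedCells-swapEntries-new c≺d =
    inverted (letter-suc-inRange L) (letter-inRange L)
             (pos-swapEntries-suc-i T L) (pos-swapEntries-i T L) (n<1+n i) c≺d

  invertedCells-swapEntries⁻ : ∀ {c d} → InvertedCells (swapEntries i T) c d →
                               InvertedCells T c d ⊎ (c ≡ pos T i × d ≡ pos T (suc i))
  invertedCells-swapEntries⁻ (inverted {x} {y} x∈ y∈ px py y<x c≺d) with pairView i x y
  ... | descent =
    inj₂ (trans (sym px) (pos-swapEntries-suc-i T L) , trans (sym py) (pos-swapEntries-i T L))
  ... | ascent  = contradiction y<x (<-asym (n<1+n i))
  ... | generic ≢descent _ =
    inj₁ (inverted (sℕ-inRange L x∈) (sℕ-inRange L y∈)
           (trans (sym (pos-swapEntries T L x)) px) (trans (sym (pos-swapEntries T L y)) py)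
           (sℕ-<-generic i y<x ≢descent) c≺d)

  ¬invertedCells-adjacent : PosInjective T → ¬ InvertedCells T (pos T i) (pos T (suc i))
  ¬invertedCells-adjacent inj (inverted {x} {y} x∈ y∈ px py y<x _)
    with inj x i x∈ (letter-inRange L) px | inj y (suc i) y∈ (letter-suc-inRange L) py
  ... | refl | refl = contradiction y<x (<-asym (n<1+n i))

-- The 0-Hecke action

≺⇒colOf≤ : ∀ {c d} → c ≺ d → proj₂ c ≤ proj₂ d
≺⇒colOf≤ (inj₁ j<j′)       = <⇒≤ j<j′
≺⇒colOf≤ (inj₂ (j≡j′ , _)) = ≤-reflexive j≡j′

nonAttacking-≺ : ∀ {n} {T : Vec Cell n} {i} → Letter n i → PosInjective T →
                 colOf T i ≤ colOf T (suc i) → ¬ Attacks (pos T i) (pos T (suc i)) →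
                 pos T i ≺ pos T (suc i)
nonAttacking-≺ {T = T} {i} L inj col≤ ¬attacks with m≤n⇒m<n∨m≡n col≤
... | inj₁ col< = inj₁ col<
... | inj₂ col≡ with proj₁ (pos T i) ≟ proj₁ (pos T (suc i))
...   | no  row≢ = contradiction (inj₁ (col≡ , row≢)) ¬attacks
...   | yes row≡ =
  contradiction (inj i (suc i) (letter-inRange L) (letter-suc-inRange L) (cong₂ _,_ row≡ col≡))
                (<⇒≢ (n<1+n i))

πact-nAD : ∀ {n} (T : Vec Cell n) i → colOf T i ≤ colOf T (suc i) →
           ¬ Attacks (pos T i) (pos T (suc i)) → πact i T ≡ just (swapEntries i T)
πact-nAD T i col≤ ¬attacks with colOf T i ≤? colOf T (suc i)
... | no col≰ = contradiction col≤ col≰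
... | yes _ with attacks? (pos T i) (pos T (suc i))
...   | yes attacks = contradiction attacks ¬attacks
...   | no _        = refl

πact-just : ∀ {n} (T : Vec Cell n) i {T′} → πact i T ≡ just T′ →
            T′ ≡ T ⊎ (T′ ≡ swapEntries i T × colOf T i ≤ colOf T (suc i) ×
                      ¬ Attacks (pos T i) (pos T (suc i)))
πact-just T i πT≡T′ with colOf T i ≤? colOf T (suc i)
... | no _     = inj₁ (sym (just-injective πT≡T′))
... | yes col≤ with attacks? (pos T i) (pos T (suc i))
...   | yes _       = contradiction πT≡T′ λ ()
...   | no ¬attacks = inj₂ (sym (just-injective πT≡T′) , col≤ , ¬attacks)

applyWord-∷ : ∀ {n} (T : Vec Cell n) i w {T′} → πact i T ≡ just T′ →
              applyWord (i ∷ w) T ≡ applyWord w T′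
applyWord-∷ T i w πT≡T′ rewrite πT≡T′ = refl

applyWord-∷⁻ : ∀ {n} (T : Vec Cell n) i w {T₂} → applyWord (i ∷ w) T ≡ just T₂ →
               Σ (Vec Cell n) λ T′ → πact i T ≡ just T′ × applyWord w T′ ≡ just T₂
applyWord-∷⁻ T i w act with πact i T | act
... | just T′ | act′ = T′ , refl , act′

-- Reading the columns

bound-swapAt : ∀ {n} (v : Vec Cell n) k → bound (swapAt v k) ≡ bound v
bound-swapAt []           _       = refl
bound-swapAt (x ∷ [])     zero    = refl
bound-swapAt (x ∷ [])     (suc k) = refl
bound-swapAt (x ∷ y ∷ v) zero    = x∙yz≈y∙xz (proj₁ y + proj₂ y) (proj₁ x + proj₂ x) (bound v)
bound-swapAt (x ∷ y ∷ v) (suc k) = cong (proj₁ x + proj₂ x +_) (bound-swapAt (y ∷ v) k)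

lookupℕ-<-bound : ∀ {n} (v : Vec Cell n) {k} → k < n →
                  proj₁ (lookupℕ v k) + proj₂ (lookupℕ v k) < bound v
lookupℕ-<-bound (x ∷ v) {zero}  _         = m<m+n (proj₁ x + proj₂ x) (bound≥1 v)
  where
  bound≥1 : ∀ {m} (u : Vec Cell m) → 0 < bound u
  bound≥1 []      = s≤s z≤n
  bound≥1 (y ∷ u) = ≤-trans (bound≥1 u) (m≤n+m _ (proj₁ y + proj₂ y))
lookupℕ-<-bound (x ∷ v) {suc k} (s≤s k<n) =
  ≤-trans (lookupℕ-<-bound v k<n) (m≤n+m _ (proj₁ x + proj₂ x))

∈-oneTo : ∀ {m k} → InRange m k → k ∈ oneTo m
∈-oneTo {k = suc k} (_ , k<m) = ∈-map⁺ suc (∈-upTo⁺ k<m)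

∈-oneTo⁻ : ∀ {m k} → k ∈ oneTo m → InRange m k
∈-oneTo⁻ k∈ with ∈-map⁻ suc k∈
... | k′ , k′∈ , refl = s≤s z≤n , ∈-upTo⁻ k′∈

oneTo-unique : ∀ m → Unique (oneTo m)
oneTo-unique m = Unique.map⁺ suc-injective (Unique.applyUpTo⁺₁ id m (λ i<j _ → <⇒≢ i<j))

∈-concatMap : ∀ {A B : Set} (f : A → List B) {x xs v} → x ∈ xs → v ∈ f x → v ∈ concatMap f xs
∈-concatMap f x∈xs v∈fx = ∈-concat⁺′ v∈fx (∈-map⁺ f x∈xs)

module _ {A : Set} {P : A → Set} (P? : Decidable P) where

  filter-unique : ∀ {xs a} → Unique xs → a ∈ xs → P a → (∀ {b} → b ∈ xs → P b → b ≡ a) →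
                  filter P? xs ≡ a ∷ []
  filter-unique (a∉xs ∷ _) (here refl) Pa only =
    trans (filter-accept P? Pa)
          (cong (_ ∷_) (filter-none P? (All.tabulate λ b∈xs Pb →
                                          All.lookup a∉xs b∈xs (sym (only (there b∈xs) Pb)))))
  filter-unique {x ∷ _} (x∉xs ∷ uniq) (there a∈xs) Pa only =
    trans (filter-reject P? (λ Px → All.lookup x∉xs a∈xs (only (here refl) Px)))
          (filter-unique uniq a∈xs Pa (only ∘ there))

cellEntries : ∀ {n} → Vec Cell n → Cell → List ℕ
cellEntries {n} T cell = filter (λ a → pos T a ≟c cell) (oneTo n)

cellEntries-≡ : ∀ {n} {T : Vec Cell n} {a cell} → PosInjective T → InRange n a → pos T a ≡ cell →
                cellEntries T cell ≡ a ∷ []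
cellEntries-≡ {n} inj a∈ Ta≡cell = filter-unique _ (oneTo-unique n) (∈-oneTo a∈) Ta≡cell
  (λ b∈ Tb≡cell → inj _ _ (∈-oneTo⁻ b∈) a∈ (trans Tb≡cell (sym Ta≡cell)))

cellEntries-empty : ∀ {n} {T : Vec Cell n} {cell} → (∀ a → InRange n a → pos T a ≢ cell) →
                    cellEntries T cell ≡ []
cellEntries-empty empty = filter-none _ (All.tabulate λ a∈ → empty _ (∈-oneTo⁻ a∈))

cellEntries-swapEntries : ∀ {n} {T : Vec Cell n} {i} → Letter n i → PosInjective T → ∀ cell →
                          cellEntries (swapEntries i T) cell ≡ map (sℕ i) (cellEntries T cell)
cellEntries-swapEntries {n} {T} {i} L inj cell with anyUpTo? (λ k → pos T (suc k) ≟c cell) n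
... | yes (k , k<n , Ta≡cell) = begin
  cellEntries (swapEntries i T) cell
    ≡⟨ cellEntries-≡ (swapEntries-posInjective L inj) (sℕ-inRange L a∈) sTsa≡cell ⟩
  sℕ i (suc k) ∷ []                  ≡⟨ cong (map (sℕ i)) (sym (cellEntries-≡ inj a∈ Ta≡cell)) ⟩
  map (sℕ i) (cellEntries T cell)    ∎
  where
  open ≡-Reasoning
  a∈ : InRange n (suc k)
  a∈ = s≤s z≤n , k<n
  sTsa≡cell : pos (swapEntries i T) (sℕ i (suc k)) ≡ cell
  sTsa≡cell =
    trans (pos-swapEntries T L (sℕ i (suc k))) (trans (cong (pos T) (sℕ-involutive i (suc k))) Ta≡cell)
... | no none =
  trans (cellEntries-empty emptyAfter) (cong (map (sℕ i)) (sym (cellEntries-empty emptyBefore)))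
  where
  emptyBefore : ∀ a → InRange n a → pos T a ≢ cell
  emptyBefore (suc k) (_ , k<n) Ta≡cell = none (k , k<n , Ta≡cell)
  emptyAfter : ∀ a → InRange n a → pos (swapEntries i T) a ≢ cell
  emptyAfter a a∈ sTa≡cell =
    emptyBefore (sℕ i a) (sℕ-inRange L a∈) (trans (sym (pos-swapEntries T L a)) sTa≡cell)

readCols-swapEntries : ∀ {n} {T : Vec Cell n} {i} → Letter n i → PosInjective T →
                       readCols (swapEntries i T) ≡ map (sℕ i) (readCols T)
readCols-swapEntries {T = T} {i} L inj = begin
  readCols (swapEntries i T)
    ≡⟨ cong (λ b → byCells (oneTo b)) (bound-swapAt T (i ∸ 1)) ⟩
  byCells rows
    ≡⟨ concatMap-cong (λ c → concatMap-cong (λ r → cellEntries-swapEntries L inj (r , c)) rows) rows ⟩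
  concatMap (λ c → concatMap (λ r → map (sℕ i) (cellEntries T (r , c))) rows) rows
    ≡⟨ concatMap-cong (λ c → sym (map-concatMap (sℕ i) (λ r → cellEntries T (r , c)) rows)) rows ⟩
  concatMap (λ c → map (sℕ i) (concatMap (λ r → cellEntries T (r , c)) rows)) rows
    ≡⟨ sym (map-concatMap (sℕ i) _ rows) ⟩
  map (sℕ i) (readCols T) ∎
  where
  open ≡-Reasoning
  rows = oneTo (bound T)
  byCells : List ℕ → List ℕ
  byCells rs = concatMap (λ c → concatMap (λ r → cellEntries (swapEntries i T) (r , c)) rs) rs

∈-readCols : ∀ {n} (T : Vec Cell n) {a} → InRange n a → 1 ≤ proj₁ (pos T a) → 1 ≤ proj₂ (pos T a) →
             a ∈ readCols T
∈-readCols {n} T {suc k} a∈@(_ , k<n) 1≤row 1≤col =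
  ∈-concatMap _ (∈-oneTo (1≤col , ≤-trans (m≤n+m _ _) r+c≤b))
    (∈-concatMap _ (∈-oneTo (1≤row , ≤-trans (m≤m+n _ _) r+c≤b))
      (∈-filter⁺ _ (∈-oneTo a∈) refl))
  where
  r+c≤b : proj₁ (pos T (suc k)) + proj₂ (pos T (suc k)) ≤ bound T
  r+c≤b = <⇒≤ (lookupℕ-<-bound T k<n)

index1-∈ : ∀ {a} L → a ∈ L → Σ ℕ λ m → index1 L a ≡ suc m × nth1 L (suc m) ≡ a
index1-∈ {a} (x ∷ xs) a∈ with x ≟ a
... | yes x≡a = 0 , refl , x≡a
... | no x≢a with a∈
...   | here a≡x = contradiction (sym a≡x) x≢a
...   | there a∈xs with index1-∈ xs a∈xs
...     | m , index≡ , nth≡ rewrite index≡ = suc m , refl , nth≡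

nth1-map : ∀ (f : ℕ → ℕ) L m → f 0 ≡ 0 → nth1 (map f L) m ≡ f (nth1 L m)
nth1-map f L        zero          f0≡0 = sym f0≡0
nth1-map f []       (suc _)       f0≡0 = sym f0≡0
nth1-map f (x ∷ xs) (suc zero)    _    = refl
nth1-map f (x ∷ xs) (suc (suc m)) f0≡0 = nth1-map f xs (suc m) f0≡0

colQuot-map : ∀ {n} (T₁ T₂ : Vec Cell n) {σ} → σ 0 ≡ 0 → readCols T₂ ≡ map σ (readCols T₁) →
              ∀ {a} → a ∈ readCols T₁ → colQuot T₂ T₁ a ≡ σ a
colQuot-map T₁ T₂ {σ} σ0≡0 cols≡ {a} a∈ with index1-∈ (readCols T₁) a∈
... | m , index≡ , nth≡ = begin
  nth1 (readCols T₂) (index1 (readCols T₁) a)  ≡⟨ cong₂ nth1 cols≡ index≡ ⟩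
  nth1 (map σ (readCols T₁)) (suc m)           ≡⟨ nth1-map σ (readCols T₁) (suc m) σ0≡0 ⟩
  σ (nth1 (readCols T₁) (suc m))               ≡⟨ cong σ nth≡ ⟩
  σ a                                          ∎
  where open ≡-Reasoning

wordPerm-zero : ∀ {n w} → All (Letter n) w → wordPerm w 0 ≡ 0
wordPerm-zero []               = refl
wordPerm-zero (L ∷ Ls) rewrite sℕ-zero (proj₁ L) = wordPerm-zero Ls

-- Chains of swaps

data _↝[_]_ {n} : Vec Cell n → List ℕ → Vec Cell n → Set where
  []   : ∀ {T} → T ↝[ [] ] T
  swap : ∀ {T i js T₂} → Letter n i → pos T i ≺ pos T (suc i) →
         swapEntries i T ↝[ js ] T₂ → T ↝[ i ∷ js ] T₂

↝-letters : ∀ {n} {T T₂ : Vec Cell n} {js} → T ↝[ js ] T₂ → All (Letter n) js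
↝-letters []               = []
↝-letters (swap L _ swaps) = L ∷ ↝-letters swaps

↝-relabelling : ∀ {n} {T T₂ : Vec Cell n} {js} → T ↝[ js ] T₂ → Relabelling (wordPerm js) T T₂
↝-relabelling []                             _ _ = refl
↝-relabelling {js = _ ∷ js} (swap L _ swaps) = relabelling-∷⁺ js L (↝-relabelling swaps)

↝-inversions : ∀ {n} {T T₂ : Vec Cell n} {js} → T ↝[ js ] T₂ → inversions T + length js ≡ inversions T₂
↝-inversions []                                    = +-identityʳ _
↝-inversions {T = T} {T₂} {i ∷ js} (swap L c≺d swaps) = begin
  inversions T + suc (length js)           ≡⟨ +-suc (inversions T) (length js) ⟩
  suc (inversions T) + length js           ≡⟨ cong (_+ length js) (sym (inversions-swapEntries-≺ T L c≺d)) ⟩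
  inversions (swapEntries i T) + length js ≡⟨ ↝-inversions swaps ⟩
  inversions T₂                            ∎
  where open ≡-Reasoning

↝-readCols : ∀ {n} {T T₂ : Vec Cell n} {js} → PosInjective T → T ↝[ js ] T₂ →
             readCols T₂ ≡ map (wordPerm js) (readCols T)
↝-readCols                       inj []               = sym (map-id _)
↝-readCols {T = T} {js = i ∷ js} inj (swap L _ swaps) = begin
  _                                              ≡⟨ ↝-readCols (swapEntries-posInjective L inj) swaps ⟩
  map (wordPerm js) (readCols (swapEntries i T)) ≡⟨ cong (map (wordPerm js)) (readCols-swapEntries L inj) ⟩
  map (wordPerm js) (map (sℕ i) (readCols T))    ≡⟨ sym (map-∘ (readCols T)) ⟩
  map (wordPerm (i ∷ js)) (readCols T)           ∎
  where open ≡-Reasoning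

NewInversionsNonAttacking : ∀ {n} → Vec Cell n → Vec Cell n → Set
NewInversionsNonAttacking T₁ T = ∀ {c d} → InvertedCells T c d → ¬ InvertedCells T₁ c d → ¬ Attacks c d

record Extraction {n} (T₁ T T₂ : Vec Cell n) (is : List ℕ) : Set where
  field
    js           : List ℕ
    js⊆is        : js ⊆ is
    acts         : applyWord js T ≡ just T₂
    swaps        : T ↝[ js ] T₂
    nonAttacking : NewInversionsNonAttacking T₁ T₂

extract : ∀ {n} {T₁ : Vec Cell n} is → All (Letter n) is → ∀ {T T₂} → PosInjective T →
          NewInversionsNonAttacking T₁ T → applyWord is T ≡ just T₂ → Extraction T₁ T T₂ is
extract [] [] _ nonAttacking refl =
  record { js = [] ; js⊆is = [] ; acts = refl ; swaps = [] ; nonAttacking = nonAttacking }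
extract {T₁ = T₁} (i ∷ is) (L ∷ Ls) {T} inj nonAttacking act with applyWord-∷⁻ T i is act
... | T′ , πT≡T′ , act′ with πact-just T i πT≡T′
...   | inj₁ refl =
  record { js = js ; js⊆is = i ∷ʳ js⊆is ; acts = acts ; swaps = swaps ; nonAttacking = nonAttacking′ }
  where
  open Extraction (extract is Ls inj nonAttacking act′) renaming (nonAttacking to nonAttacking′)
...   | inj₂ (refl , col≤ , ¬attacks) = record
  { js = i ∷ js ; js⊆is = refl ∷ js⊆is ; acts = trans (applyWord-∷ T i js πT≡T′) acts
  ; swaps = swap L (nonAttacking-≺ L inj col≤ ¬attacks) swaps ; nonAttacking = nonAttacking′ }
  where
  nonAttacking-swapped : NewInversionsNonAttacking T₁ (swapEntries i T)
  nonAttacking-swapped inv ¬inv₁ with invertedCells-swapEntries⁻ T L inv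
  ... | inj₁ invT          = nonAttacking invT ¬inv₁
  ... | inj₂ (refl , refl) = ¬attacks
  open Extraction (extract is Ls (swapEntries-posInjective L inj) nonAttacking-swapped act′)
    renaming (nonAttacking to nonAttacking′)

-- A tight word attains the bound of inversions-relabelling-≤, so each of its letters must
-- raise the inversion number, i.e. swap an ascent.
tightWord-acts : ∀ {n} {T₁ T₂ : Vec Cell n} w → All (Letter n) w → ∀ {T} →
                 Relabelling (wordPerm w) T T₂ → inversions T + length w ≤ inversions T₂ → PosInjective T →
                 (∀ {c d} → InvertedCells T₁ c d → InvertedCells T c d) → NewInversionsNonAttacking T₁ T₂ →
                 applyWord w T ≡ just T₂ × (∀ {c d} → InvertedCells T c d → InvertedCells T₂ c d)
tightWord-acts [] [] rel _ _ _ _ = cong just T≡T₂ , subst (λ X → InvertedCells X _ _) T≡T₂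
  where
  T≡T₂ = pos-ext (λ y y∈ → sym (rel y y∈))
tightWord-acts {T₁ = T₁} {T₂} (i ∷ w) (L ∷ Ls) {T} rel tight inj T₁⊆T nonAttacking =
  trans (applyWord-∷ T i w (πact-nAD T i (≺⇒colOf≤ c≺d) ¬attacks)) acts ,
  T′⊆T₂ ∘ invertedCells-swapEntries⁺ T L c≺d
  where
  rel′ = relabelling-∷⁻ w L rel
  c≺d : pos T i ≺ pos T (suc i)
  c≺d with pos T i ≺? pos T (suc i)
  ... | yes c≺d = c≺d
  ... | no c⊀d  = contradiction (begin-strict
    inversions T + length w                 <⟨ +-monoʳ-< (inversions T) (n<1+n (length w)) ⟩
    inversions T + length (i ∷ w)           ≤⟨ tight ⟩
    inversions T₂                           ≤⟨ inversions-relabelling-≤ w Ls rel′ ⟩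
    inversions (swapEntries i T) + length w ≤⟨ +-monoˡ-≤ (length w) (inversions-swapEntries-⊀ T L c⊀d) ⟩
    inversions T + length w                 ∎) (<-irrefl refl)
    where open ≤-Reasoning
  tight′ : inversions (swapEntries i T) + length w ≤ inversions T₂
  tight′ = begin
    inversions (swapEntries i T) + length w ≡⟨ cong (_+ length w) (inversions-swapEntries-≺ T L c≺d) ⟩
    suc (inversions T) + length w           ≡⟨ sym (+-suc (inversions T) (length w)) ⟩
    inversions T + length (i ∷ w)           ≤⟨ tight ⟩
    inversions T₂                           ∎
    where open ≤-Reasoning
  rest = tightWord-acts w Ls rel′ tight′ (swapEntries-posInjective L inj)
                        (invertedCells-swapEntries⁺ T L c≺d ∘ T₁⊆T) nonAttacking
  acts = proj₁ rest
  T′⊆T₂ = proj₂ rest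
  ¬attacks = nonAttacking (T′⊆T₂ (invertedCells-swapEntries-new T L c≺d))
                          (¬invertedCells-adjacent T L inj ∘ T₁⊆T)

∈-readCols-SCT : ∀ {n α β} {T : Vec Cell n} → IsSCT n α β T → ∀ {a} → InRange n a → a ∈ readCols T
∈-readCols-SCT {T = T} sct a∈ with IsSCT.inShape sct _ a∈
... | (1≤row , _ , 1≤col , _) , _ = ∈-readCols T a∈ 1≤row 1≤col

lemma2p22 : (n : ℕ) (α β : List ℕ) → IsComposition α → IsComposition β → β ≤c α →
    (T₁ T₂ : Vec Cell n) → IsSCT n α β T₁ → IsSCT n α β T₂ →
    (is : List ℕ) → All (Letter n) is → applyWord is T₁ ≡ just T₂ →
    (Σ (List ℕ) λ js → (js ⊆ is) × (applyWord js T₁ ≡ just T₂) ×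
        IsReducedWord n js (colQuot T₂ T₁))
    × ((w : List ℕ) → IsReducedWord n w (colQuot T₂ T₁) → applyWord w T₁ ≡ just T₂)
lemma2p22 n α β _ _ _ T₁ T₂ sct₁ _ is letters act =
  (js , js⊆is , acts , ↝-letters swaps , colQuot≗ , shortest) , reducedWord-acts
  where
  injective = IsSCT.inj sct₁
  open Extraction (extract is letters injective (λ inv ¬inv → contradiction inv ¬inv) act)

  colQuot≗ : PermEq n (wordPerm js) (colQuot T₂ T₁)
  colQuot≗ a a∈ = sym (colQuot-map T₁ T₂ (wordPerm-zero (↝-letters swaps)) (↝-readCols injective swaps)
                                   (∈-readCols-SCT sct₁ a∈))

  relabelling : ∀ w → PermEq n (wordPerm w) (colQuot T₂ T₁) → Relabelling (wordPerm w) T₁ T₂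
  relabelling w w≗ y y∈ =
    trans (cong (pos T₂) (trans (w≗ y y∈) (sym (colQuot≗ y y∈)))) (↝-relabelling swaps y y∈)

  shortest : ∀ w → All (Letter n) w → PermEq n (wordPerm w) (colQuot T₂ T₁) → length js ≤ length w
  shortest w lw w≗ = +-cancelˡ-≤ (inversions T₁) _ _
    (≤-trans (≤-reflexive (↝-inversions swaps)) (inversions-relabelling-≤ w lw (relabelling w w≗)))

  reducedWord-acts : ∀ w → IsReducedWord n w (colQuot T₂ T₁) → applyWord w T₁ ≡ just T₂
  reducedWord-acts w (lw , w≗ , minimal) =
    proj₁ (tightWord-acts w lw (relabelling w w≗) tight injective id nonAttacking)
    where
    tight : inversions T₁ + length w ≤ inversions T₂
    tight = ≤-trans (+-monoʳ-≤ (inversions T₁) (minimal js (↝-letters swaps) colQuot≗))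
                    (≤-reflexive (↝-inversions swaps))
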